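{- Let $t$ be an indeterminate (equivalently, an arbitrary rational or integer parameter), and define the polynomials \[ \begin{aligned} x_1&=t^4 + 6t^3 - 32t^2 - 158t + 279, & x_2&=4t^3 + 28t^2 + 4t - 420,\\ x_3&=t^4 + 6t^3 - 4t^2 - 102t - 93, & x_4&=t^4 - 50t^2 - 56t + 393,\\ y_1&=t^4 + 8t^3 - 26t^2 - 112t + 321, & y_2&=t^4 + 2t^3 - 16t^2 + 46t + 63,\\ y_3&=4t^3 - 4t^2 - 60t + 348, & y_4&=t^4 + 2t^3 - 44t^2 - 10t + 435. \end{aligned} \] Then $\sum_{i=1}^4 x_i^r=\sum_{i=1}^4 y_i^r$ holds identically in $t$ for $r=2,4,6$. Consequently, setting $x_{i+4}=-x_i$ and $y_{i+4}=-y_i$ for $i=1,\dots,4$, one has $\sum_{i=1}^8 x_i^r=\sum_{i=1}^8 y_i^r$ identically in $t$ for $r=1,2,\dots,7$, i.e. these give a parametric ideal solution of degree 4 of the Tarry–Escott problem of degree 7.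
   Context: The Tarry–Escott problem of degree $k$ asks for two distinct multisets of integers $\{x_1,\dots,x_s\}$ and $\{y_1,\dots,y_s\}$ with $\sum_{i=1}^s x_i^r=\sum_{i=1}^s y_i^r$ for $r=1,\dots,k$; a solution with $s=k+1$ is called ideal. -}

module Defs where

open import Data.Nat using (ℕ)
open import Data.Integer using (ℤ; +_; -_; _+_; _-_; _*_; _^_)
open import Data.List using (List; []; _∷_; map; foldr; _++_)

x₁ x₂ x₃ x₄ y₁ y₂ y₃ y₄ : ℤ → ℤ
x₁ t = t ^ 4 + + 6 * t ^ 3 - + 32 * t ^ 2 - + 158 * t + + 279
x₂ t = + 4 * t ^ 3 + + 28 * t ^ 2 + + 4 * t - + 420
x₃ t = t ^ 4 + + 6 * t ^ 3 - + 4 * t ^ 2 - + 102 * t - + 93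
x₄ t = t ^ 4 - + 50 * t ^ 2 - + 56 * t + + 393
y₁ t = t ^ 4 + + 8 * t ^ 3 - + 26 * t ^ 2 - + 112 * t + + 321
y₂ t = t ^ 4 + + 2 * t ^ 3 - + 16 * t ^ 2 + + 46 * t + + 63
y₃ t = + 4 * t ^ 3 - + 4 * t ^ 2 - + 60 * t + + 348
y₄ t = t ^ 4 + + 2 * t ^ 3 - + 44 * t ^ 2 - + 10 * t + + 435

xs4 ys4 : ℤ → List ℤ
xs4 t = x₁ t ∷ x₂ t ∷ x₃ t ∷ x₄ t ∷ []
ys4 t = y₁ t ∷ y₂ t ∷ y₃ t ∷ y₄ t ∷ []

xs8 ys8 : ℤ → List ℤ
xs8 t = xs4 t ++ map -_ (xs4 t)
ys8 t = ys4 t ++ map -_ (ys4 t)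

powerSum : ℕ → List ℤ → ℤ
powerSum r as = foldr _+_ (+ 0) (map (λ a → a ^ r) as)

-- For r = 2, 4, 6 the two sides are polynomials in t with integer coefficients; expanding them
-- as coefficient lists, the identities hold coefficientwise, which the type checker verifies by
-- evaluation. Appending the negatives of a list kills its odd power sums and doubles its even
-- ones, so the identities for r = 2, 4, 6 give the eight-term identities for all r ≤ 7.
module Submission where

open import Data.Nat as ℕ using (ℕ; _≤_; suc; s≤s)
open import Data.Integer using (ℤ; +_; -_; _+_; _-_; _*_; _^_; 0ℤ; 1ℤ)
open import Data.Integer.Properties
  using (+-identityˡ; +-identityʳ; *-zeroʳ; +-assoc; +-inverseʳ; neg-distrib-+;
         neg-distribˡ-*; ^-*-assoc)
open import Data.Integer.Tactic.RingSolver using (solve-∀)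
open import Data.List using (List; []; _∷_; map; foldr; _++_)
open import Data.Product using (_×_; _,_)
open import Relation.Binary.PropositionalEquality using (_≡_; refl; sym; trans; cong; cong₂)
open import Relation.Binary.PropositionalEquality.Properties using (module ≡-Reasoning)
open import Defs

open ≡-Reasoning

-- Polynomials over ℤ as coefficient lists, constant term first.
Poly : Set
Poly = List ℤ

eval : Poly → ℤ → ℤ
eval []      t = 0ℤ
eval (a ∷ p) t = a + t * eval p t

evalAll : List Poly → ℤ → List ℤ
evalAll ps t = map (λ p → eval p t) ps

infixl 6 _+ₚ_
infixl 7 _·ₚ_ _*ₚ_
infixr 8 _^ₚ_

_+ₚ_ : Poly → Poly → Poly
[]      +ₚ q       = q
(a ∷ p) +ₚ []      = a ∷ p
(a ∷ p) +ₚ (b ∷ q) = a + b ∷ p +ₚ q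

_·ₚ_ : ℤ → Poly → Poly
a ·ₚ []      = []
a ·ₚ (b ∷ q) = a * b ∷ a ·ₚ q

_*ₚ_ : Poly → Poly → Poly
[]      *ₚ q = []
(a ∷ p) *ₚ q = a ·ₚ q +ₚ (0ℤ ∷ p *ₚ q)

_^ₚ_ : Poly → ℕ → Poly
p ^ₚ ℕ.zero  = 1ℤ ∷ []
p ^ₚ suc n   = p *ₚ p ^ₚ n

powerSumₚ : ℕ → List Poly → Poly
powerSumₚ r ps = foldr _+ₚ_ [] (map (_^ₚ r) ps)

eval-+ₚ : ∀ p q t → eval (p +ₚ q) t ≡ eval p t + eval q t
eval-+ₚ []      q       t = sym (+-identityˡ (eval q t))
eval-+ₚ (a ∷ p) []      t = sym (+-identityʳ _)
eval-+ₚ (a ∷ p) (b ∷ q) t = begin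
  a + b + t * eval (p +ₚ q) t          ≡⟨ cong (λ s → a + b + t * s) (eval-+ₚ p q t) ⟩
  a + b + t * (eval p t + eval q t)    ≡⟨ rearrange a b t (eval p t) (eval q t) ⟩
  a + t * eval p t + (b + t * eval q t) ∎
  where
  rearrange : ∀ a b t x y → a + b + t * (x + y) ≡ a + t * x + (b + t * y)
  rearrange = solve-∀

eval-·ₚ : ∀ a q t → eval (a ·ₚ q) t ≡ a * eval q t
eval-·ₚ a []      t = sym (*-zeroʳ a)
eval-·ₚ a (b ∷ q) t = begin
  a * b + t * eval (a ·ₚ q) t ≡⟨ cong (λ s → a * b + t * s) (eval-·ₚ a q t) ⟩
  a * b + t * (a * eval q t)  ≡⟨ rearrange a b t (eval q t) ⟩
  a * (b + t * eval q t)      ∎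
  where
  rearrange : ∀ a b t x → a * b + t * (a * x) ≡ a * (b + t * x)
  rearrange = solve-∀

eval-*ₚ : ∀ p q t → eval (p *ₚ q) t ≡ eval p t * eval q t
eval-*ₚ []      q t = refl
eval-*ₚ (a ∷ p) q t = begin
  eval (a ·ₚ q +ₚ (0ℤ ∷ p *ₚ q)) t              ≡⟨ eval-+ₚ (a ·ₚ q) (0ℤ ∷ p *ₚ q) t ⟩
  eval (a ·ₚ q) t + (0ℤ + t * eval (p *ₚ q) t)  ≡⟨ cong₂ (λ u v → u + (0ℤ + t * v))
                                                         (eval-·ₚ a q t) (eval-*ₚ p q t) ⟩
  a * eval q t + (0ℤ + t * (eval p t * eval q t)) ≡⟨ rearrange a t (eval p t) (eval q t) ⟩
  (a + t * eval p t) * eval q t                  ∎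
  where
  rearrange : ∀ a t x y → a * y + (0ℤ + t * (x * y)) ≡ (a + t * x) * y
  rearrange = solve-∀

eval-^ₚ : ∀ p n t → eval (p ^ₚ n) t ≡ eval p t ^ n
eval-^ₚ p ℕ.zero  t = cong (λ s → 1ℤ + s) (*-zeroʳ t)
eval-^ₚ p (suc n) t = begin
  eval (p *ₚ p ^ₚ n) t           ≡⟨ eval-*ₚ p (p ^ₚ n) t ⟩
  eval p t * eval (p ^ₚ n) t     ≡⟨ cong (eval p t *_) (eval-^ₚ p n t) ⟩
  eval p t * eval p t ^ n        ∎

eval-powerSumₚ : ∀ r ps t → eval (powerSumₚ r ps) t ≡ powerSum r (evalAll ps t)
eval-powerSumₚ r []       t = refl
eval-powerSumₚ r (p ∷ ps) t = begin
  eval (p ^ₚ r +ₚ powerSumₚ r ps) t              ≡⟨ eval-+ₚ (p ^ₚ r) (powerSumₚ r ps) t ⟩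
  eval (p ^ₚ r) t + eval (powerSumₚ r ps) t      ≡⟨ cong₂ _+_ (eval-^ₚ p r t) (eval-powerSumₚ r ps t) ⟩
  eval p t ^ r + powerSum r (evalAll ps t)       ∎

powerSum-evalAll-cong : ∀ r ps qs → powerSumₚ r ps ≡ powerSumₚ r qs →
                        ∀ t → powerSum r (evalAll ps t) ≡ powerSum r (evalAll qs t)
powerSum-evalAll-cong r ps qs eq t = begin
  powerSum r (evalAll ps t)  ≡⟨ sym (eval-powerSumₚ r ps t) ⟩
  eval (powerSumₚ r ps) t    ≡⟨ cong (λ p → eval p t) eq ⟩
  eval (powerSumₚ r qs) t    ≡⟨ eval-powerSumₚ r qs t ⟩
  powerSum r (evalAll qs t)  ∎

xs4ₚ ys4ₚ : List Poly
xs4ₚ = (+ 279 ∷ - + 158 ∷ - + 32 ∷ + 6 ∷ + 1 ∷ [])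
     ∷ (- + 420 ∷ + 4 ∷ + 28 ∷ + 4 ∷ [])
     ∷ (- + 93 ∷ - + 102 ∷ - + 4 ∷ + 6 ∷ + 1 ∷ [])
     ∷ (+ 393 ∷ - + 56 ∷ - + 50 ∷ 0ℤ ∷ + 1 ∷ []) ∷ []
ys4ₚ = (+ 321 ∷ - + 112 ∷ - + 26 ∷ + 8 ∷ + 1 ∷ [])
     ∷ (+ 63 ∷ + 46 ∷ - + 16 ∷ + 2 ∷ + 1 ∷ [])
     ∷ (+ 348 ∷ - + 60 ∷ - + 4 ∷ + 4 ∷ [])
     ∷ (+ 435 ∷ - + 10 ∷ - + 44 ∷ + 2 ∷ + 1 ∷ []) ∷ []

-- The solver does not recognise ℤ's _^_, so the powers t ^ k are written out as the products
-- they unfold to; each equation is then definitionally the claim for the matching xᵢ or yᵢ.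
xs4≡evalAll : ∀ t → xs4 t ≡ evalAll xs4ₚ t
xs4≡evalAll t = cong₂ _∷_ (e₁ t) (cong₂ _∷_ (e₂ t) (cong₂ _∷_ (e₃ t) (cong₂ _∷_ (e₄ t) refl)))
  where
  e₁ : ∀ t → t * (t * (t * (t * 1ℤ))) + + 6 * (t * (t * (t * 1ℤ))) - + 32 * (t * (t * 1ℤ)) - + 158 * t + + 279
           ≡ + 279 + t * (- + 158 + t * (- + 32 + t * (+ 6 + t * (+ 1 + t * 0ℤ))))
  e₁ = solve-∀
  e₂ : ∀ t → + 4 * (t * (t * (t * 1ℤ))) + + 28 * (t * (t * 1ℤ)) + + 4 * t - + 420
           ≡ - + 420 + t * (+ 4 + t * (+ 28 + t * (+ 4 + t * 0ℤ)))
  e₂ = solve-∀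
  e₃ : ∀ t → t * (t * (t * (t * 1ℤ))) + + 6 * (t * (t * (t * 1ℤ))) - + 4 * (t * (t * 1ℤ)) - + 102 * t - + 93
           ≡ - + 93 + t * (- + 102 + t * (- + 4 + t * (+ 6 + t * (+ 1 + t * 0ℤ))))
  e₃ = solve-∀
  e₄ : ∀ t → t * (t * (t * (t * 1ℤ))) - + 50 * (t * (t * 1ℤ)) - + 56 * t + + 393
           ≡ + 393 + t * (- + 56 + t * (- + 50 + t * (0ℤ + t * (+ 1 + t * 0ℤ))))
  e₄ = solve-∀

ys4≡evalAll : ∀ t → ys4 t ≡ evalAll ys4ₚ t
ys4≡evalAll t = cong₂ _∷_ (e₁ t) (cong₂ _∷_ (e₂ t) (cong₂ _∷_ (e₃ t) (cong₂ _∷_ (e₄ t) refl)))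
  where
  e₁ : ∀ t → t * (t * (t * (t * 1ℤ))) + + 8 * (t * (t * (t * 1ℤ))) - + 26 * (t * (t * 1ℤ)) - + 112 * t + + 321
           ≡ + 321 + t * (- + 112 + t * (- + 26 + t * (+ 8 + t * (+ 1 + t * 0ℤ))))
  e₁ = solve-∀
  e₂ : ∀ t → t * (t * (t * (t * 1ℤ))) + + 2 * (t * (t * (t * 1ℤ))) - + 16 * (t * (t * 1ℤ)) + + 46 * t + + 63
           ≡ + 63 + t * (+ 46 + t * (- + 16 + t * (+ 2 + t * (+ 1 + t * 0ℤ))))
  e₂ = solve-∀
  e₃ : ∀ t → + 4 * (t * (t * (t * 1ℤ))) - + 4 * (t * (t * 1ℤ)) - + 60 * t + + 348
           ≡ + 348 + t * (- + 60 + t * (- + 4 + t * (+ 4 + t * 0ℤ)))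
  e₃ = solve-∀
  e₄ : ∀ t → t * (t * (t * (t * 1ℤ))) + + 2 * (t * (t * (t * 1ℤ))) - + 44 * (t * (t * 1ℤ)) - + 10 * t + + 435
           ≡ + 435 + t * (- + 10 + t * (- + 44 + t * (+ 2 + t * (+ 1 + t * 0ℤ))))
  e₄ = solve-∀

powerSum-xs4≡ys4 : ∀ r → powerSumₚ r xs4ₚ ≡ powerSumₚ r ys4ₚ →
                   ∀ t → powerSum r (xs4 t) ≡ powerSum r (ys4 t)
powerSum-xs4≡ys4 r eq t = begin
  powerSum r (xs4 t)             ≡⟨ cong (powerSum r) (xs4≡evalAll t) ⟩
  powerSum r (evalAll xs4ₚ t)    ≡⟨ powerSum-evalAll-cong r xs4ₚ ys4ₚ eq t ⟩
  powerSum r (evalAll ys4ₚ t)    ≡⟨ cong (powerSum r) (sym (ys4≡evalAll t)) ⟩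
  powerSum r (ys4 t)             ∎

neg-^-even : ∀ a k → (- a) ^ (2 ℕ.* k) ≡ a ^ (2 ℕ.* k)
neg-^-even a k = begin
  (- a) ^ (2 ℕ.* k)   ≡⟨ sym (^-*-assoc (- a) 2 k) ⟩
  ((- a) ^ 2) ^ k     ≡⟨ cong (_^ k) (square-neg a) ⟩
  (a ^ 2) ^ k         ≡⟨ ^-*-assoc a 2 k ⟩
  a ^ (2 ℕ.* k)       ∎
  where
  square-neg : ∀ a → (- a) * ((- a) * 1ℤ) ≡ a * (a * 1ℤ)
  square-neg = solve-∀

neg-^-odd : ∀ a k → (- a) ^ suc (2 ℕ.* k) ≡ - a ^ suc (2 ℕ.* k)
neg-^-odd a k = begin
  (- a) * (- a) ^ (2 ℕ.* k)  ≡⟨ cong ((- a) *_) (neg-^-even a k) ⟩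
  (- a) * a ^ (2 ℕ.* k)      ≡⟨ sym (neg-distribˡ-* a _) ⟩
  - (a * a ^ (2 ℕ.* k))      ∎

withNegatives : List ℤ → List ℤ
withNegatives as = as ++ map -_ as

powerSum-++ : ∀ r as bs → powerSum r (as ++ bs) ≡ powerSum r as + powerSum r bs
powerSum-++ r []       bs = sym (+-identityˡ _)
powerSum-++ r (a ∷ as) bs = trans (cong (λ s → a ^ r + s) (powerSum-++ r as bs)) (sym (+-assoc (a ^ r) _ _))

powerSum-map-neg-even : ∀ k as → powerSum (2 ℕ.* k) (map -_ as) ≡ powerSum (2 ℕ.* k) as
powerSum-map-neg-even k []       = refl
powerSum-map-neg-even k (a ∷ as) = cong₂ _+_ (neg-^-even a k) (powerSum-map-neg-even k as)

powerSum-map-neg-odd : ∀ k as → powerSum (suc (2 ℕ.* k)) (map -_ as) ≡ - powerSum (suc (2 ℕ.* k)) as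
powerSum-map-neg-odd k []       = refl
powerSum-map-neg-odd k (a ∷ as) =
  trans (cong₂ _+_ (neg-^-odd a k) (powerSum-map-neg-odd k as))
        (sym (neg-distrib-+ (a ^ suc (2 ℕ.* k)) (powerSum (suc (2 ℕ.* k)) as)))

powerSum-withNegatives-even : ∀ k as →
  powerSum (2 ℕ.* k) (withNegatives as) ≡ powerSum (2 ℕ.* k) as + powerSum (2 ℕ.* k) as
powerSum-withNegatives-even k as =
  trans (powerSum-++ (2 ℕ.* k) as (map -_ as))
        (cong (λ s → powerSum (2 ℕ.* k) as + s) (powerSum-map-neg-even k as))

powerSum-withNegatives-odd : ∀ k as → powerSum (suc (2 ℕ.* k)) (withNegatives as) ≡ 0ℤ
powerSum-withNegatives-odd k as = begin
  powerSum r (as ++ map -_ as)            ≡⟨ powerSum-++ r as (map -_ as) ⟩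
  powerSum r as + powerSum r (map -_ as)  ≡⟨ cong (λ s → powerSum r as + s) (powerSum-map-neg-odd k as) ⟩
  powerSum r as - powerSum r as           ≡⟨ +-inverseʳ (powerSum r as) ⟩
  0ℤ                                      ∎
  where r = suc (2 ℕ.* k)

powerSum-withNegatives-even-cong : ∀ k as bs → powerSum (2 ℕ.* k) as ≡ powerSum (2 ℕ.* k) bs →
  powerSum (2 ℕ.* k) (withNegatives as) ≡ powerSum (2 ℕ.* k) (withNegatives bs)
powerSum-withNegatives-even-cong k as bs eq = begin
  powerSum r (withNegatives as)  ≡⟨ powerSum-withNegatives-even k as ⟩
  powerSum r as + powerSum r as  ≡⟨ cong (λ s → s + s) eq ⟩
  powerSum r bs + powerSum r bs  ≡⟨ sym (powerSum-withNegatives-even k bs) ⟩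
  powerSum r (withNegatives bs)  ∎
  where r = 2 ℕ.* k

powerSum-withNegatives-odd-cong : ∀ k as bs →
  powerSum (suc (2 ℕ.* k)) (withNegatives as) ≡ powerSum (suc (2 ℕ.* k)) (withNegatives bs)
powerSum-withNegatives-odd-cong k as bs =
  trans (powerSum-withNegatives-odd k as) (sym (powerSum-withNegatives-odd k bs))

mainTheorem1 : (t : ℤ) →
    (powerSum 2 (xs4 t) ≡ powerSum 2 (ys4 t)
      × powerSum 4 (xs4 t) ≡ powerSum 4 (ys4 t)
      × powerSum 6 (xs4 t) ≡ powerSum 6 (ys4 t))
    × ((r : ℕ) → 1 ≤ r → r ≤ 7 → powerSum r (xs8 t) ≡ powerSum r (ys8 t))
mainTheorem1 t = (sum₂ , sum₄ , sum₆) , ideal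
  where
  sum₂ : powerSum 2 (xs4 t) ≡ powerSum 2 (ys4 t)
  sum₂ = powerSum-xs4≡ys4 2 refl t
  sum₄ : powerSum 4 (xs4 t) ≡ powerSum 4 (ys4 t)
  sum₄ = powerSum-xs4≡ys4 4 refl t
  sum₆ : powerSum 6 (xs4 t) ≡ powerSum 6 (ys4 t)
  sum₆ = powerSum-xs4≡ys4 6 refl t

  odd : ∀ k → powerSum (suc (2 ℕ.* k)) (xs8 t) ≡ powerSum (suc (2 ℕ.* k)) (ys8 t)
  odd k = powerSum-withNegatives-odd-cong k (xs4 t) (ys4 t)

  ideal : (r : ℕ) → 1 ≤ r → r ≤ 7 → powerSum r (xs8 t) ≡ powerSum r (ys8 t)
  ideal 1 _ _ = odd 0
  ideal 2 _ _ = powerSum-withNegatives-even-cong 1 (xs4 t) (ys4 t) sum₂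
  ideal 3 _ _ = odd 1
  ideal 4 _ _ = powerSum-withNegatives-even-cong 2 (xs4 t) (ys4 t) sum₄
  ideal 5 _ _ = odd 2
  ideal 6 _ _ = powerSum-withNegatives-even-cong 3 (xs4 t) (ys4 t) sum₆
  ideal 7 _ _ = odd 3
  ideal (suc (suc (suc (suc (suc (suc (suc (suc _)))))))) _ (s≤s (s≤s (s≤s (s≤s (s≤s (s≤s (s≤s ())))))))
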